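{- There is an absolute constant $C$ such that, for any $n\ge 2$, any proper edge-coloring of $K_n$ using at most $Kn$ colors, and any vertex $v$, there is a sequence $S$ of at most $CK\log n$ colors such that every vertex of $K_n$ lies in $\mathrm{span}(S;v)$.
   Context: A proper edge-coloring is one in which each color class is a matching. For a vertex $v$ and a sequence $S$ of colors, $\mathrm{span}(S;v)$ is the set of vertices that can be reached from $v$ by a path whose sequence of edge colors (in order along the path) forms a subsequence of $S$. -}

module Defs where

open import Data.Nat using (ℕ)
open import Data.Fin using (Fin)
open import Data.List using (List; []; _∷_)
open import Data.List.Relation.Unary.Unique.Propositional using (Unique)
open import Data.List.Relation.Binary.Sublist.Propositional using (_⊆_)
open import Data.Product using (Σ; _×_; ∃)
open import Relation.Binary.PropositionalEquality using (_≡_; _≢_)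

-- An edge-colouring of K_n with palette Fin m: the colour of edge {u,w} (u ≢ w)
-- is c u w; values on the diagonal are irrelevant.
EdgeColouring : ℕ → ℕ → Set
EdgeColouring n m = Fin n → Fin n → Fin m

IsProper : ∀ {n m} → EdgeColouring n m → Set
IsProper {n} c =
  ((u w : Fin n) → u ≢ w → c u w ≡ c w u) ×
  ((u w w′ : Fin n) → u ≢ w → u ≢ w′ → w ≢ w′ → c u w ≢ c u w′)

-- A path starting at x is given by the list of subsequent vertices.
endpoint : ∀ {n} → Fin n → List (Fin n) → Fin n
endpoint x []       = x
endpoint x (y ∷ ys) = endpoint y ys

pathColours : ∀ {n m} → EdgeColouring n m → Fin n → List (Fin n) → List (Fin m)
pathColours c x []       = []
pathColours c x (y ∷ ys) = c x y ∷ pathColours c y ys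

InSpan : ∀ {n m} → EdgeColouring n m → List (Fin m) → Fin n → Fin n → Set
InSpan {n} c S v u =
  Σ (List (Fin n)) λ xs → Unique (v ∷ xs) × endpoint v xs ≡ u × pathColours c v xs ⊆ S

{-# OPTIONS --safe #-}
module Submission where

-- Keep a set R ∋ v of vertices, each reached from v by a path inside R whose colours form
-- a subsequence of S, and append one colour to S per round.  With r = |R| and s = n − r,
-- each of the s·r pairs (a ∈ R, b ∉ R) is an edge of exactly one colour, and by properness
-- a colour has at most one edge from R to a given b; so some colour joins R to at least
-- s·r/m new vertices.  Adding them multiplies s/r by at most P/(P+Q), where m·Q ≤ P·n.
-- By Bernoulli's inequality suc (P / Q) rounds halve s/r, and 2(1 + ⌊log₂ n⌋) halvings
-- take it from at most n to below 1/n, i.e. s = 0.  A proper colouring of K_n has at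
-- least n − 1 colours, so Q ≤ 2P and the number of rounds is O((P/Q) · log n).

open import Defs
open import Data.Nat.Base
  using (ℕ; zero; suc; _+_; _*_; _^_; _≤_; _<_; z≤n; s≤s; s≤s⁻¹; NonZero; >-nonZero; _/_; _%_)
open import Data.Nat.Properties
  using (+-*-semiring; module ≤-Reasoning; _≤?_; _<?_; ≤-refl; ≤-reflexive; ≤-trans; ≤-antisym;
         <⇒≤; ≰⇒>; ≮⇒≥; ≤⇒≯; n≮n; m≤n⇒m≤1+n; m≤m+n; m≤n+m; m<n+m; m≤n*m;
         +-comm; +-assoc; +-suc; +-identityʳ; +-cancelˡ-≡; +-mono-≤; +-monoˡ-≤; +-monoʳ-≤;
         *-identityʳ; *-distribʳ-+; *-mono-≤; *-monoˡ-≤; *-monoʳ-≤; *-mono-<; *-cancelˡ-≤;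
         m^n>0; ^-*-assoc; ^-distribˡ-+-*)
open import Data.Nat.DivMod using (m≡m%n+[m/n]*n; m%n<n; m/n*n≤m)
open import Data.Nat.Logarithm using (⌊log₂_⌋; ⌊log₂⌋-mono-≤; ⌊log₂[2^n]⌋≡n)
open import Data.Nat.Tactic.RingSolver using (solve-∀)
open import Algebra.Properties.Semiring.Sum +-*-semiring
  using (sum; sum-syntax; sum-cong-≗; sum-replicate-zero; ∑-comm; ∑-distrib-+;
         *-distribˡ-sum; *-distribʳ-sum)
open import Data.Bool.Base using (Bool; true; false; not; _∧_; _∨_; T; if_then_else_)
open import Data.Bool.Properties using (T-∧; T-∨)
open import Data.Fin.Base using (Fin; zero; suc)
import Data.Fin.Properties as Fin
open import Data.Fin.Properties using (_≟_; any?; injective⇒≤)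
open import Data.List.Base using (List; []; _∷_; _++_; [_]; length)
open import Data.List.Properties using (length-++)
open import Data.List.Membership.Propositional using (_∈_)
open import Data.List.Relation.Unary.Any using (here)
open import Data.List.Relation.Unary.All as All using (All; []; _∷_)
import Data.List.Relation.Unary.All.Properties as Allₚ
open import Data.List.Relation.Unary.AllPairs using ([]; _∷_)
open import Data.List.Relation.Unary.Unique.Propositional using (Unique)
import Data.List.Relation.Unary.Unique.Propositional.Properties as Uniqueₚ
open import Data.List.Relation.Binary.Sublist.Propositional using (_⊆_; []; _∷_; ⊆-refl; ⊆-trans)
import Data.List.Relation.Binary.Sublist.Propositional.Properties as Sublistₚ
open import Data.Product.Base using (Σ; _×_; _,_; proj₁; proj₂; ∃-syntax)
open import Data.Sum.Base using (inj₁; inj₂)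
open import Data.Empty using (⊥)
open import Function.Base using (_∘_)
open import Function.Bundles using (Equivalence)
open import Relation.Nullary.Negation using (¬_; contradiction)
open import Relation.Nullary.Decidable using (yes; no; ⌊_⌋; toWitness; fromWitness; T?)
open import Relation.Binary.PropositionalEquality
  using (_≡_; _≢_; refl; sym; trans; cong; subst; subst₂; module ≡-Reasoning)

open Equivalence using (to; from)

-- Arithmetic

bernoulli : ∀ a q k → a ^ k * (a + k * q) ≤ a * (a + q) ^ k
bernoulli a q zero = ≤-reflexive (base a q)
  where
  base : ∀ a q → 1 * (a + 0 * q) ≡ a * 1
  base = solve-∀
bernoulli a q (suc k) = begin
  a ^ suc k * (a + suc k * q)                      ≤⟨ m≤m+n _ (a ^ k * k * q * q) ⟩
  a ^ suc k * (a + suc k * q) + a ^ k * k * q * q  ≡⟨ expand (a ^ k) a q k ⟩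
  (a + q) * (a ^ k * (a + k * q))                  ≤⟨ *-monoʳ-≤ (a + q) (bernoulli a q k) ⟩
  (a + q) * (a * (a + q) ^ k)                      ≡⟨ swap (a + q) a ((a + q) ^ k) ⟩
  a * (a + q) ^ suc k                              ∎
  where
  open ≤-Reasoning
  expand : ∀ x a q k → a * x * (a + (q + k * q)) + x * k * q * q ≡ (a + q) * (x * (a + k * q))
  expand = solve-∀
  swap : ∀ b a y → b * (a * y) ≡ a * (b * y)
  swap = solve-∀

doubling : ∀ a q k .{{_ : NonZero a}} → a ≤ k * q → 2 * a ^ k ≤ (a + q) ^ k
doubling a q k a≤kq = *-cancelˡ-≤ a (begin
  a * (2 * a ^ k)      ≡⟨ rearrange a (a ^ k) ⟩
  a ^ k * (a + a)      ≤⟨ *-monoʳ-≤ (a ^ k) (+-monoʳ-≤ a a≤kq) ⟩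
  a ^ k * (a + k * q)  ≤⟨ bernoulli a q k ⟩
  a * (a + q) ^ k      ∎)
  where
  open ≤-Reasoning
  rearrange : ∀ a x → a * (2 * x) ≡ x * (a + a)
  rearrange = solve-∀

m*n≤o⇒m^j*n^j≤o^j : ∀ {m n o} j → m * n ≤ o → m ^ j * n ^ j ≤ o ^ j
m*n≤o⇒m^j*n^j≤o^j zero _ = ≤-refl
m*n≤o⇒m^j*n^j≤o^j {m} {n} {o} (suc j) mn≤o = begin
  m * m ^ j * (n * n ^ j)    ≡⟨ interchange m (m ^ j) n (n ^ j) ⟩
  (m * n) * (m ^ j * n ^ j)  ≤⟨ *-mono-≤ mn≤o (m*n≤o⇒m^j*n^j≤o^j j mn≤o) ⟩
  o * o ^ j                  ∎
  where
  open ≤-Reasoning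
  interchange : ∀ a b c d → a * b * (c * d) ≡ (a * c) * (b * d)
  interchange = solve-∀

n<2^suc⌊log₂n⌋ : ∀ n → n < 2 ^ suc ⌊log₂ n ⌋
n<2^suc⌊log₂n⌋ n with 2 ^ suc ⌊log₂ n ⌋ ≤? n
... | no  2^L≰n = ≰⇒> 2^L≰n
... | yes 2^L≤n = contradiction
  (subst (_≤ ⌊log₂ n ⌋) (⌊log₂[2^n]⌋≡n (suc ⌊log₂ n ⌋)) (⌊log₂⌋-mono-≤ 2^L≤n))
  (n≮n _)

0<⌊log₂n⌋ : ∀ {n} → 2 ≤ n → 0 < ⌊log₂ n ⌋
0<⌊log₂n⌋ {n} 2≤n = subst (_≤ ⌊log₂ n ⌋) (⌊log₂[2^n]⌋≡n 1) (⌊log₂⌋-mono-≤ 2≤n)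

-- Counting subsets of Fin n

sum-mono-≤ : ∀ {n} {f g : Fin n → ℕ} → (∀ i → f i ≤ g i) → sum f ≤ sum g
sum-mono-≤ {zero}  _   = z≤n
sum-mono-≤ {suc n} f≤g = +-mono-≤ (f≤g zero) (sum-mono-≤ (f≤g ∘ suc))

term≤sum : ∀ {n} (f : Fin n → ℕ) i → f i ≤ sum f
term≤sum f zero    = m≤m+n (f zero) _
term≤sum f (suc i) = ≤-trans (term≤sum (f ∘ suc) i) (m≤n+m _ (f zero))

averaging : ∀ {n} (f : Fin n → ℕ) → 0 < sum f → ∃[ i ] sum f ≤ n * f i
averaging {suc n} f _ with 0 <? sum (f ∘ suc)
... | no  tail≯0 = zero , +-monoʳ-≤ (f zero) (≤-trans (≮⇒≥ tail≯0) z≤n)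
... | yes 0<tail with averaging (f ∘ suc) 0<tail
...   | i , tail≤ with f zero ≤? f (suc i)
...     | yes f₀≤fᵢ = suc i , +-mono-≤ f₀≤fᵢ tail≤
...     | no  f₀≰fᵢ =
  zero , +-monoʳ-≤ (f zero) (≤-trans tail≤ (*-monoʳ-≤ n (<⇒≤ (≰⇒> f₀≰fᵢ))))

T-not : ∀ {x} → T (not x) → ¬ T x
T-not {true} ()

¬T⇒T-not : ∀ {x} → ¬ T x → T (not x)
¬T⇒T-not {true}  ¬x = ¬x _
¬T⇒T-not {false} _  = _

χ : Bool → ℕ
χ b = if b then 1 else 0

χ-∧ : ∀ x y → χ (x ∧ y) ≡ χ x * χ y
χ-∧ true  y = sym (+-identityʳ (χ y))
χ-∧ false y = refl

χ-∨ : ∀ x y → (T x → T y → ⊥) → χ (x ∨ y) ≡ χ x + χ y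
χ-∨ true  true  disjoint = contradiction _ (disjoint _)
χ-∨ true  false _        = refl
χ-∨ false y     _        = refl

count : ∀ {n} → (Fin n → Bool) → ℕ
count {n} P = ∑[ i < n ] χ (P i)

count-complement : ∀ {n} (P : Fin n → Bool) → count P + count (not ∘ P) ≡ n
count-complement {zero}  P = refl
count-complement {suc n} P with P zero
... | true  = cong suc (count-complement (P ∘ suc))
... | false = trans (+-suc _ _) (cong suc (count-complement (P ∘ suc)))

count≤n : ∀ {n} (P : Fin n → Bool) → count P ≤ n
count≤n P = subst (count P ≤_) (count-complement P) (m≤m+n _ _)

count-pos : ∀ {n} (P : Fin n → Bool) {i} → T (P i) → 0 < count P
count-pos P {i} Pᵢ = ≤-trans (χ-pos Pᵢ) (term≤sum (χ ∘ P) i)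
  where
  χ-pos : ∀ {x} → T x → 0 < χ x
  χ-pos {true} _ = s≤s z≤n

count-none : ∀ {n} {P : Fin n → Bool} → (∀ i → ¬ T (P i)) → count P ≡ 0
count-none {n} none = trans (sum-cong-≗ (λ i → χ-false (none i))) (sum-replicate-zero n)
  where
  χ-false : ∀ {x} → ¬ T x → χ x ≡ 0
  χ-false {true}  ¬x = contradiction _ ¬x
  χ-false {false} _  = refl

count-∪ : ∀ {n} {P Q : Fin n → Bool} → (∀ i → T (P i) → T (Q i) → ⊥) →
          count (λ i → P i ∨ Q i) ≡ count P + count Q
count-∪ {P = P} {Q} disjoint =
  trans (sum-cong-≗ (λ i → χ-∨ (P i) (Q i) (disjoint i))) (∑-distrib-+ (χ ∘ P) (χ ∘ Q))

count≤1 : ∀ {n} {P : Fin n → Bool} → (∀ {i j} → T (P i) → T (P j) → i ≡ j) → count P ≤ 1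
count≤1 {zero}          _      = z≤n
count≤1 {suc n} {P} unique with P zero in P₀≡
... | true  = ≤-reflexive (cong suc (count-none {P = P ∘ suc} λ i Pᵢ₊₁ →
                contradiction (unique (subst T (sym P₀≡) _) Pᵢ₊₁) λ ()))
... | false = count≤1 (λ Pᵢ Pⱼ → Fin.suc-injective (unique Pᵢ Pⱼ))

anyᶠ : ∀ {n} → (Fin n → Bool) → Bool
anyᶠ P = ⌊ any? (T? ∘ P) ⌋

count≤χ-any : ∀ {n} (P : Fin n → Bool) → (∀ {i j} → T (P i) → T (P j) → i ≡ j) →
              count P ≤ χ (anyᶠ P)
count≤χ-any P unique with any? (T? ∘ P)
... | yes _    = count≤1 unique
... | no  none = ≤-reflexive (count-none {P = P} λ i Pᵢ → none (i , Pᵢ))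

count-singleton : ∀ {n} (i : Fin n) → count (λ j → ⌊ i ≟ j ⌋) ≡ 1
count-singleton i = ≤-antisym
  (count≤1 {P = λ j → ⌊ i ≟ j ⌋} λ i≡j i≡k → trans (sym (toWitness i≡j)) (toWitness i≡k))
  (count-pos (λ j → ⌊ i ≟ j ⌋) (fromWitness refl))

image : ∀ {n m} → (Fin n → Fin m) → (Fin n → Bool) → Fin m → Bool
image f R y = anyᶠ (λ a → R a ∧ ⌊ f a ≟ y ⌋)

T-∧-≟ : ∀ {m x} {i j : Fin m} → T (x ∧ ⌊ i ≟ j ⌋) → T x × i ≡ j
T-∧-≟ x∧i≡j = let x , i≡j = to T-∧ x∧i≡j in x , toWitness i≡j

image-witness : ∀ {n m} {f : Fin n → Fin m} {R y} → T (image f R y) → ∃[ a ] T (R a) × f a ≡ y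
image-witness {f = f} {R} {y} y∈ =
  let a , a↦y = toWitness {a? = any? (T? ∘ λ a → R a ∧ ⌊ f a ≟ y ⌋)} y∈ in a , T-∧-≟ a↦y

count≤count-image : ∀ {n m} (f : Fin n → Fin m) (R : Fin n → Bool) →
                    (∀ {a a′} → T (R a) → T (R a′) → f a ≡ f a′ → a ≡ a′) →
                    count R ≤ count (image f R)
count≤count-image {n} {m} f R injective = begin
  count R                                         ≡⟨ sum-cong-≗ times-one ⟨
  ∑[ a < n ] (χ (R a) * count (hits a))           ≡⟨ sum-cong-≗ distribute ⟩
  ∑[ a < n ] ∑[ y < m ] (χ (R a) * χ (hits a y))  ≡⟨ sum-cong-≗ (sum-cong-≗ ∘ χ-∧-hits) ⟨
  ∑[ a < n ] ∑[ y < m ] χ (R a ∧ hits a y)        ≡⟨ ∑-comm (λ a y → χ (R a ∧ hits a y)) ⟩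
  ∑[ y < m ] ∑[ a < n ] χ (R a ∧ hits a y)        ≤⟨ sum-mono-≤ at-most-one ⟩
  count (image f R)                               ∎
  where
  open ≤-Reasoning
  hits : Fin n → Fin m → Bool
  hits a y = ⌊ f a ≟ y ⌋
  distribute : ∀ a → χ (R a) * count (hits a) ≡ ∑[ y < m ] (χ (R a) * χ (hits a y))
  distribute a = *-distribˡ-sum (χ (R a)) (χ ∘ hits a)
  χ-∧-hits : ∀ a y → χ (R a ∧ hits a y) ≡ χ (R a) * χ (hits a y)
  χ-∧-hits a = χ-∧ (R a) ∘ hits a
  times-one : ∀ a → χ (R a) * count (hits a) ≡ χ (R a)
  times-one a = trans (cong (χ (R a) *_) (count-singleton (f a))) (*-identityʳ _)
  one-preimage : ∀ y {a a′} → T (R a ∧ hits a y) → T (R a′ ∧ hits a′ y) → a ≡ a′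
  one-preimage y a↦y a′↦y =
    let Ra , fa≡y = T-∧-≟ a↦y ; Ra′ , fa′≡y = T-∧-≟ a′↦y in
    injective Ra Ra′ (trans fa≡y (sym fa′≡y))
  at-most-one : ∀ y → ∑[ a < n ] χ (R a ∧ hits a y) ≤ χ (image f R y)
  at-most-one y = count≤χ-any (λ a → R a ∧ hits a y) (one-preimage y)

-- Paths and proper colourings

endpoint-++ : ∀ {n} (x : Fin n) xs y → endpoint x (xs ++ [ y ]) ≡ y
endpoint-++ x []       y = refl
endpoint-++ x (z ∷ xs) y = endpoint-++ z xs y

pathColours-++ : ∀ {n m} (c : EdgeColouring n m) x xs y →
                 pathColours c x (xs ++ [ y ]) ≡ pathColours c x xs ++ [ c (endpoint x xs) y ]
pathColours-++ c x []       y = refl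
pathColours-++ c x (z ∷ xs) y = cong (c x z ∷_) (pathColours-++ c z xs y)

colour-injective : ∀ {n m} {c : EdgeColouring n m} → IsProper c →
                   ∀ {b a a′} → b ≢ a → b ≢ a′ → c a b ≡ c a′ b → a ≡ a′
colour-injective (symmetric , matching) {b} {a} {a′} b≢a b≢a′ cab≡ca′b with a ≟ a′
... | yes a≡a′ = a≡a′
... | no  a≢a′ = contradiction
  (trans (symmetric b a b≢a) (trans cab≡ca′b (symmetric a′ b (b≢a′ ∘ sym))))
  (matching b a a′ b≢a b≢a′ a≢a′)

proper⇒n≤1+m : ∀ {n m} {c : EdgeColouring n m} → IsProper c → n ≤ suc m
proper⇒n≤1+m {zero}          _              = z≤n
proper⇒n≤1+m {suc n} {c = c} (_ , matching) = s≤s (injective⇒≤ {f = λ i → c zero (suc i)} fan)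
  where
  fan : ∀ {i j} → c zero (suc i) ≡ c zero (suc j) → i ≡ j
  fan {i} {j} c₀ᵢ≡c₀ⱼ with i ≟ j
  ... | yes i≡j = i≡j
  ... | no  i≢j = contradiction c₀ᵢ≡c₀ⱼ
                    (matching zero (suc i) (suc j) (λ ()) (λ ()) (i≢j ∘ Fin.suc-injective))

frontier : ∀ {n m} → EdgeColouring n m → (Fin n → Bool) → Fin m → Fin n → Bool
frontier c R col b = not (R b) ∧ image (λ a → c a b) R col

frontier-count : ∀ {n m} {c : EdgeColouring n m} → IsProper c → (R : Fin n → Bool) →
                 count (not ∘ R) * count R ≤ ∑[ col < m ] count (frontier c R col)
frontier-count {n} {m} {c} proper R = begin
  count (not ∘ R) * count R                         ≡⟨ *-distribʳ-sum (count R) (χ ∘ not ∘ R) ⟩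
  ∑[ b < n ] (outside b * count R)                  ≤⟨ sum-mono-≤ more-colours ⟩
  ∑[ b < n ] (outside b * count (into b))           ≡⟨ sum-cong-≗ distribute ⟩
  ∑[ b < n ] ∑[ k < m ] (outside b * χ (into b k))  ≡⟨ sum-cong-≗ (sum-cong-≗ ∘ χ-∧-into) ⟨
  ∑[ b < n ] ∑[ k < m ] χ (frontier c R k b)        ≡⟨ ∑-comm (λ b k → χ (frontier c R k b)) ⟩
  ∑[ k < m ] count (frontier c R k)                 ∎
  where
  open ≤-Reasoning
  outside : Fin n → ℕ
  outside b = χ (not (R b))
  into : Fin n → Fin m → Bool
  into b = image (λ a → c a b) R
  distribute : ∀ b → outside b * count (into b) ≡ ∑[ k < m ] (outside b * χ (into b k))
  distribute b = *-distribˡ-sum (outside b) (χ ∘ into b)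
  χ-∧-into : ∀ b k → χ (frontier c R k b) ≡ outside b * χ (into b k)
  χ-∧-into b = χ-∧ (not (R b)) ∘ into b
  more-colours : ∀ b → outside b * count R ≤ outside b * count (into b)
  more-colours b with R b in Rb≡
  ... | true  = z≤n
  ... | false = *-monoʳ-≤ 1 (count≤count-image (λ a → c a b) R λ Ra Ra′ →
                  colour-injective proper (b∉ Ra) (b∉ Ra′))
    where
    b∉ : ∀ {a} → T (R a) → b ≢ a
    b∉ Ra refl = subst T Rb≡ Ra

module Reachable {n m} (c : EdgeColouring n m) (v : Fin n) where

  record SpanWithin (R : Fin n → Bool) (S : List (Fin m)) (u : Fin n) : Set where
    field
      path     : List (Fin n)
      unique   : Unique (v ∷ path)
      inside   : All (T ∘ R) (v ∷ path)
      reaches  : endpoint v path ≡ u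
      coloured : pathColours c v path ⊆ S

  Spanned : (Fin n → Bool) → List (Fin m) → Set
  Spanned R S = ∀ u → T (R u) → SpanWithin R S u

  toInSpan : ∀ {R S u} → SpanWithin R S u → InSpan c S v u
  toInSpan σ = path , unique , reaches , coloured
    where open SpanWithin σ

  SpanWithin-mono : ∀ {R R′ S S′ u} → (∀ {x} → T (R x) → T (R′ x)) → S ⊆ S′ →
                    SpanWithin R S u → SpanWithin R′ S′ u
  SpanWithin-mono R⊆R′ S⊆S′ σ = record
    { path     = path
    ; unique   = unique
    ; inside   = All.map R⊆R′ inside
    ; reaches  = reaches
    ; coloured = ⊆-trans coloured S⊆S′
    }
    where open SpanWithin σ

  -- The new vertex u lies outside R, hence off the old path, which stays inside R.
  SpanWithin-extend : ∀ {R R′ S a u} → (∀ {x} → T (R x) → T (R′ x)) → ¬ T (R u) → T (R′ u) →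
                      SpanWithin R S a → SpanWithin R′ (S ++ [ c a u ]) u
  SpanWithin-extend {S = S} {a} {u} R⊆R′ u∉R u∈R′ σ = record
    { path     = path ++ [ u ]
    ; unique   = Uniqueₚ.++⁺ unique ([] ∷ []) fresh
    ; inside   = Allₚ.++⁺ (All.map R⊆R′ inside) (u∈R′ ∷ [])
    ; reaches  = endpoint-++ v path u
    ; coloured = subst (_⊆ S ++ [ c a u ]) (sym (pathColours-++ c v path u))
                   (Sublistₚ.++⁺ coloured (cong (λ x → c x u) reaches ∷ []))
    }
    where
    open SpanWithin σ
    fresh : ∀ {x} → ¬ (x ∈ v ∷ path × x ∈ [ u ])
    fresh (x∈path , here refl) = u∉R (All.lookup inside x∈path)

  spanned-source : Spanned (λ x → ⌊ v ≟ x ⌋) []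
  spanned-source u v≡u = record
    { path     = []
    ; unique   = [] ∷ []
    ; inside   = fromWitness refl ∷ []
    ; reaches  = toWitness v≡u
    ; coloured = []
    }

  grow : (Fin n → Bool) → Fin m → Fin n → Bool
  grow R col x = R x ∨ frontier c R col x

  ⊆-grow : ∀ R col {x} → T (R x) → T (grow R col x)
  ⊆-grow R col = from T-∨ ∘ inj₁

  spanned-grow : ∀ {R S} col → Spanned R S → Spanned (grow R col) (S ++ [ col ])
  spanned-grow {R} {S} col spanned u u∈ with to T-∨ u∈
  ... | inj₁ u∈R = SpanWithin-mono (⊆-grow R col) (Sublistₚ.++⁺ʳ [ col ] ⊆-refl) (spanned u u∈R)
  ... | inj₂ u∈F =
    let u∉R , u-hit = to T-∧ u∈F
        a , a∈R , cau≡col = image-witness {f = λ a → c a u} {R} u-hit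
    in subst (λ k → SpanWithin (grow R col) (S ++ [ k ]) u) cau≡col
         (SpanWithin-extend (⊆-grow R col) (T-not u∉R) u∈ (spanned a a∈R))

-- The greedy procedure

-- Uses (s′ + d) (r + d) = s′ r + d n, where n = r + s′ + d.
greedy-ratio : ∀ P Q m r s′ d → (s′ + d) * r ≤ m * d → m * Q ≤ P * (r + (s′ + d)) →
               s′ * r * (P + Q) ≤ (s′ + d) * (r + d) * P
greedy-ratio P Q m r s′ d large few = begin
  s′ * r * (P + Q)              ≡⟨ split s′ r P Q ⟩
  x + s′ * r * Q                ≤⟨ +-monoʳ-≤ x (*-monoˡ-≤ Q (*-monoˡ-≤ r (m≤m+n s′ d))) ⟩
  x + (s′ + d) * r * Q          ≤⟨ +-monoʳ-≤ x (*-monoˡ-≤ Q large) ⟩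
  x + m * d * Q                 ≡⟨ cong (x +_) (swap m d Q) ⟩
  x + d * (m * Q)               ≤⟨ +-monoʳ-≤ x (*-monoʳ-≤ d few) ⟩
  x + d * (P * (r + (s′ + d)))  ≡⟨ collect s′ r d P ⟩
  (s′ + d) * (r + d) * P        ∎
  where
  open ≤-Reasoning
  x : ℕ
  x = s′ * r * P
  split : ∀ s r P Q → s * r * (P + Q) ≡ s * r * P + s * r * Q
  split = solve-∀
  swap : ∀ m d Q → m * d * Q ≡ d * (m * Q)
  swap = solve-∀
  collect : ∀ s r d P → s * r * P + d * (P * (r + (s + d))) ≡ (s + d) * (r + d) * P
  collect = solve-∀

potential-step : ∀ A B n r r′ s s′ t → 0 < r → s′ * r * B ≤ s * r′ * A →
                 s * B ^ t ≤ n * r * A ^ t → s′ * B ^ suc t ≤ n * r′ * A ^ suc t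
potential-step A B n r r′ s s′ t 0<r ratio potential =
  *-cancelˡ-≤ r {{>-nonZero 0<r}} (begin
    r * (s′ * (B * B ^ t))      ≡⟨ e₁ r s′ B (B ^ t) ⟩
    s′ * r * B * B ^ t          ≤⟨ *-monoˡ-≤ (B ^ t) ratio ⟩
    s * r′ * A * B ^ t          ≡⟨ e₂ s r′ A (B ^ t) ⟩
    s * B ^ t * (r′ * A)        ≤⟨ *-monoˡ-≤ (r′ * A) potential ⟩
    n * r * A ^ t * (r′ * A)    ≡⟨ e₃ n r (A ^ t) r′ A ⟩
    r * (n * r′ * (A * A ^ t))  ∎)
  where
  open ≤-Reasoning
  e₁ : ∀ r s B x → r * (s * (B * x)) ≡ s * r * B * x
  e₁ = solve-∀
  e₂ : ∀ s r A x → s * r * A * x ≡ s * x * (r * A)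
  e₂ = solve-∀
  e₃ : ∀ n r x r′ A → n * r * x * (r′ * A) ≡ r * (n * r′ * (A * x))
  e₃ = solve-∀

module Greedy {n m} (c : EdgeColouring n m) (proper : IsProper c) (v : Fin n)
              (P Q : ℕ) (few-colours : m * Q ≤ P * n) where

  open Reachable c v

  record Stage (t : ℕ) : Set where
    field
      reached   : Fin n → Bool
      colours   : List (Fin m)
      spanned   : Spanned reached colours
      source    : T (reached v)
      length≤   : length colours ≤ t
      potential : count (not ∘ reached) * (P + Q) ^ t ≤ n * count reached * P ^ t

  start : Stage 0
  start = record
    { reached   = R₀
    ; colours   = []
    ; spanned   = spanned-source
    ; source    = fromWitness refl
    ; length≤   = z≤n
    ; potential = *-monoˡ-≤ 1 (begin
        count (not ∘ R₀)  ≤⟨ count≤n (not ∘ R₀) ⟩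
        n                 ≡⟨ *-identityʳ n ⟨
        n * 1             ≡⟨ cong (n *_) (count-singleton v) ⟨
        n * count R₀      ∎)
    }
    where
    open ≤-Reasoning
    R₀ : Fin n → Bool
    R₀ x = ⌊ v ≟ x ⌋

  idle : ∀ {t} (st : Stage t) → count (not ∘ Stage.reached st) ≡ 0 → Stage (suc t)
  idle {t} st done = record
    { reached   = reached
    ; colours   = colours
    ; spanned   = spanned
    ; source    = source
    ; length≤   = m≤n⇒m≤1+n length≤
    ; potential = ≤-trans (≤-reflexive (cong (_* (P + Q) ^ suc t) done)) z≤n
    }
    where open Stage st

  advance : ∀ {t} (st : Stage t) → 0 < count (not ∘ Stage.reached st) → Stage (suc t)
  advance {t} st 0<s = record
    { reached   = grow R col
    ; colours   = S ++ [ col ]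
    ; spanned   = spanned-grow col spanned
    ; source    = ⊆-grow R col source
    ; length≤   = subst (_≤ suc t) (sym (trans (length-++ S) (+-comm (length S) 1))) (s≤s length≤)
    ; potential = potential-step P (P + Q) n r r′ s s′ t (count-pos R source) ratio potential
    }
    where
    open Stage st renaming (reached to R; colours to S)
    r s : ℕ
    r = count R
    s = count (not ∘ R)
    best : ∃[ col ] ∑[ k < m ] count (frontier c R k) ≤ m * count (frontier c R col)
    best = averaging (λ k → count (frontier c R k))
                     (≤-trans (*-mono-≤ 0<s (count-pos R source)) (frontier-count proper R))
    col : Fin m
    col = proj₁ best
    d r′ s′ : ℕ
    d  = count (frontier c R col)
    r′ = count (grow R col)
    s′ = count (not ∘ grow R col)
    r′≡r+d : r′ ≡ r + d
    r′≡r+d = count-∪ {P = R} {Q = frontier c R col} (λ b Rb Fb → T-not (proj₁ (to T-∧ Fb)) Rb)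
    n≡r+s : n ≡ r + s
    n≡r+s = sym (count-complement R)
    s≡s′+d : s ≡ s′ + d
    s≡s′+d = +-cancelˡ-≡ r s (s′ + d) (begin
      r + s         ≡⟨ n≡r+s ⟨
      n             ≡⟨ count-complement (grow R col) ⟨
      r′ + s′       ≡⟨ cong (_+ s′) r′≡r+d ⟩
      r + d + s′    ≡⟨ +-assoc r d s′ ⟩
      r + (d + s′)  ≡⟨ cong (r +_) (+-comm d s′) ⟩
      r + (s′ + d)  ∎)
      where open ≡-Reasoning
    ratio : s′ * r * (P + Q) ≤ s * r′ * P
    ratio = subst₂ (λ x y → s′ * r * (P + Q) ≤ x * y * P) (sym s≡s′+d) (sym r′≡r+d)
      (greedy-ratio P Q m r s′ d
        (subst (λ x → x * r ≤ m * d) s≡s′+d (≤-trans (frontier-count proper R) (proj₂ best)))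
        (subst (λ x → m * Q ≤ P * x) (trans n≡r+s (cong (r +_) s≡s′+d)) few-colours))

  next : ∀ {t} → Stage t → Stage (suc t)
  next st with count (not ∘ Stage.reached st) in s≡
  ... | zero  = idle st s≡
  ... | suc _ = advance st (subst (0 <_) (sym s≡) (s≤s z≤n))

  stage : ∀ t → Stage t
  stage zero    = start
  stage (suc t) = next (stage t)

  spans-all : ∀ t → n * n * P ^ t < (P + Q) ^ t → ∀ u → InSpan c (Stage.colours (stage t)) v u
  spans-all t enough u with T? (Stage.reached (stage t) u)
  ... | yes u∈ = toInSpan (Stage.spanned (stage t) u u∈)
  ... | no  u∉ = contradiction enough (≤⇒≯ (begin
    (P + Q) ^ t                          ≤⟨ m≤n*m _ _ {{>-nonZero 0<s}} ⟩
    count (not ∘ reached) * (P + Q) ^ t  ≤⟨ potential ⟩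
    n * count reached * P ^ t            ≤⟨ *-monoˡ-≤ (P ^ t) (*-monoʳ-≤ n (count≤n reached)) ⟩
    n * n * P ^ t                        ∎))
    where
    open Stage (stage t)
    open ≤-Reasoning
    0<s : 0 < count (not ∘ reached)
    0<s = count-pos (not ∘ reached) (¬T⇒T-not u∉)

-- Each block of suc (P / Q) rounds gains a factor 2 (doubling), and 2 ^ (2 (1 + ⌊log₂ n⌋)) > n².
rounds : (P Q n : ℕ) .{{_ : NonZero Q}} → ℕ
rounds P Q n = suc (P / Q) * (suc ⌊log₂ n ⌋ + suc ⌊log₂ n ⌋)

rounds-suffice : ∀ P Q n .{{_ : NonZero P}} .{{_ : NonZero Q}} →
                 n * n * P ^ rounds P Q n < (P + Q) ^ rounds P Q n
rounds-suffice P Q n = begin-strict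
  n * n * P ^ (k * j)        <⟨ m<n+m _ (m^n>0 P (k * j)) ⟩
  suc (n * n) * P ^ (k * j)  ≤⟨ *-monoˡ-≤ (P ^ (k * j)) n*n<2^j ⟩
  2 ^ j * P ^ (k * j)        ≡⟨ cong (2 ^ j *_) (^-*-assoc P k j) ⟨
  2 ^ j * (P ^ k) ^ j        ≤⟨ m*n≤o⇒m^j*n^j≤o^j {2} {P ^ k} j (doubling P Q k P≤kQ) ⟩
  ((P + Q) ^ k) ^ j          ≡⟨ ^-*-assoc (P + Q) k j ⟩
  (P + Q) ^ (k * j)          ∎
  where
  open ≤-Reasoning
  L k j : ℕ
  L = ⌊log₂ n ⌋
  k = suc (P / Q)
  j = suc L + suc L
  P≤kQ : P ≤ k * Q
  P≤kQ = begin
    P                  ≡⟨ m≡m%n+[m/n]*n P Q ⟩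
    P % Q + P / Q * Q  ≤⟨ +-monoˡ-≤ (P / Q * Q) (<⇒≤ (m%n<n P Q)) ⟩
    k * Q              ∎
  n*n<2^j : n * n < 2 ^ j
  n*n<2^j = subst (n * n <_) (sym (^-distribˡ-+-* 2 (suc L) (suc L)))
                  (*-mono-< (n<2^suc⌊log₂n⌋ n) (n<2^suc⌊log₂n⌋ n))

rounds-cost : ∀ P Q n .{{_ : NonZero Q}} → 2 ≤ n → Q ≤ 2 * P →
              rounds P Q n * Q ≤ 12 * P * ⌊log₂ n ⌋
rounds-cost P Q n 2≤n Q≤2P = begin
  k * j * Q                        ≡⟨ rearrange k j Q ⟩
  j * (k * Q)                      ≤⟨ *-mono-≤ j≤4L (+-mono-≤ Q≤2P (m/n*n≤m P Q)) ⟩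
  (L + L + (L + L)) * (2 * P + P)  ≡⟨ twelve L P ⟩
  12 * P * L                       ∎
  where
  open ≤-Reasoning
  L k j : ℕ
  L = ⌊log₂ n ⌋
  k = suc (P / Q)
  j = suc L + suc L
  j≤4L : j ≤ L + L + (L + L)
  j≤4L = let 1+L≤2L = +-monoˡ-≤ L (0<⌊log₂n⌋ 2≤n) in +-mono-≤ 1+L≤2L 1+L≤2L
  rearrange : ∀ k j Q → k * j * Q ≡ j * (k * Q)
  rearrange = solve-∀
  twelve : ∀ L P → (L + L + (L + L)) * (2 * P + P) ≡ 12 * P * L
  twelve = solve-∀

Q≤2P : ∀ {n m P Q} → 2 ≤ n → n ≤ suc m → m * Q ≤ P * n → Q ≤ 2 * P
Q≤2P {n} {m} {P} {Q} 2≤n n≤1+m mQ≤Pn = *-cancelˡ-≤ n {{>-nonZero 0<n}} (begin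
  n * Q          ≤⟨ *-monoˡ-≤ Q (≤-trans n≤1+m (+-monoˡ-≤ m 1≤m)) ⟩
  (m + m) * Q    ≡⟨ *-distribʳ-+ Q m m ⟩
  m * Q + m * Q  ≤⟨ +-mono-≤ mQ≤Pn mQ≤Pn ⟩
  P * n + P * n  ≡⟨ double P n ⟩
  n * (2 * P)    ∎)
  where
  open ≤-Reasoning
  0<n : 0 < n
  0<n = ≤-trans (s≤s z≤n) 2≤n
  1≤m : 1 ≤ m
  1≤m = s≤s⁻¹ (≤-trans 2≤n n≤1+m)
  double : ∀ P n → P * n + P * n ≡ n * (2 * P)
  double = solve-∀

short-spanning-sequence :
  ∀ {n m} P Q .{{_ : NonZero P}} .{{_ : NonZero Q}} → 2 ≤ n → m * Q ≤ P * n →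
  (c : EdgeColouring n m) → IsProper c → (v : Fin n) →
  ∃[ S ] length S * Q ≤ 12 * P * ⌊log₂ n ⌋ × (∀ u → InSpan c S v u)
short-spanning-sequence {n} P Q 2≤n few-colours c proper v =
  Stage.colours (stage t) , length-bound , spans-all t (rounds-suffice P Q n)
  where
  open Greedy c proper v P Q few-colours
  open ≤-Reasoning
  t : ℕ
  t = rounds P Q n
  length-bound : length (Stage.colours (stage t)) * Q ≤ 12 * P * ⌊log₂ n ⌋
  length-bound = begin
    length (Stage.colours (stage t)) * Q  ≤⟨ *-monoˡ-≤ Q (Stage.length≤ (stage t)) ⟩
    t * Q                                 ≤⟨ rounds-cost P Q n 2≤n
                                               (Q≤2P {P = P} 2≤n (proper⇒n≤1+m proper) few-colours) ⟩
    12 * P * ⌊log₂ n ⌋                    ∎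

corollary1p6 : Σ ℕ λ C →
    (n : ℕ) → 2 ≤ n →
    (p q m : ℕ) → m * suc q ≤ suc p * n →
    (c : EdgeColouring n m) → IsProper c →
    (v : Fin n) →
    Σ (List (Fin m)) λ S →
      (length S * suc q ≤ C * suc p * ⌊log₂ n ⌋) × ((u : Fin n) → InSpan c S v u)
corollary1p6 = 12 , λ n 2≤n p q m → short-spanning-sequence (suc p) (suc q) 2≤n
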